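{- Let $G$ be a complete signed graph, let $u\neq v$ with $\{u,v\}$ of sign $+$ in $G$, and let $H$ be obtained from $G$ by flipping the sign of $\{u,v\}$ to $-$. Let $w\in N_{G^+}(u)$ and $T=|N_{G^+}(u)\,\Delta\,N_{G^+}(w)|$. \begin{enumerate} \item If $u$ and $w$ are in $\varepsilon$-agreement in $G^+$, then they are in $\varepsilon$-agreement in $H^+$ if any of the following holds: (a) $w\in N_{G^+}(u)\setminus N_{G^+}(v)$, $w\neq v$, and $|N_{G^+}(u)|\leq|N_{G^+}(w)|$; (b) $w\in N_{G^+}(u)\setminus N_{G^+}(v)$, $w\neq v$, $|N_{G^+}(u)|>|N_{G^+}(w)|$, and $T\leq|N_{G^+}(u)|$. \item If $u$ and $w$ are not in $\varepsilon$-agreement in $G^+$, then they are not in $\varepsilon$-agreement in $H^+$ if any of the following holds: (a) $w\in N_{G^+}(u)\cap N_{G^+}(v)$; (b) $w\in N_{G^+}(u)\setminus N_{G^+}(v)$, $w\neq v$, $|N_{G^+}(u)|>|N_{G^+}(w)|$, and $T>|N_{G^+}(u)|$. \end{enumerate}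
   Context: A complete signed graph on a finite vertex set $V$ assigns to every unordered pair of distinct vertices a sign $+$ or $-$. For such a graph $X$, its positive graph $X^+$ has vertex set $V$ and as edges the pairs of sign $+$; $N_{X^+}(a)$ is the open neighborhood of $a$ in $X^+$. Fix $\varepsilon>0$. $\mathrm{NonAgreement}_{X^+}(a,b)=\frac{|N_{X^+}(a)\,\Delta\,N_{X^+}(b)|}{\max\{|N_{X^+}(a)|,|N_{X^+}(b)|\}}$. Vertices $a,b$ are in $\varepsilon$-agreement in $X^+$ if $\{a,b\}$ is an edge of $X^+$ and $\mathrm{NonAgreement}_{X^+}(a,b)<\varepsilon$.
   Formalization: The parameter ε ranges over the positive rationals instead of the positive reals. -}

module Defs where

open import Data.Nat using (ℕ; zero; suc; _⊔_)
open import Data.Integer using (+_)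
open import Data.Rational using (ℚ; 0ℚ; _/_; _<_)
open import Data.Bool using (Bool; true; false; if_then_else_; _∧_; _∨_)
open import Data.Fin using (Fin; _≟_)
open import Data.Fin.Subset using (Subset; inside; outside; _∪_; _─_; ∣_∣; _∈_)
open import Data.Vec using (tabulate)
open import Data.Product using (_×_)
open import Relation.Nullary using (¬_)
open import Relation.Nullary.Decidable using (⌊_⌋)
open import Relation.Binary.PropositionalEquality using (_≡_)

-- A complete signed graph on vertex set Fin n: sign a b = true means "+",
-- false means "-". Only its values on pairs a ≠ b matter; it must be
-- symmetric (signs live on unordered pairs), see `Symmetric`.
SignedGraph : ℕ → Set
SignedGraph n = Fin n → Fin n → Bool

Symmetric : ∀ {n} → SignedGraph n → Set
Symmetric {n} X = (a b : Fin n) → X a b ≡ X b a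

N⁺ : ∀ {n} → SignedGraph n → Fin n → Subset n
N⁺ X a = tabulate λ x → if ⌊ x ≟ a ⌋ then outside else (if X a x then inside else outside)

Edge⁺ : ∀ {n} → SignedGraph n → Fin n → Fin n → Set
Edge⁺ X a b = ¬ (a ≡ b) × X a b ≡ true

_Δ_ : ∀ {n} → Subset n → Subset n → Subset n
p Δ q = (p ─ q) ∪ (q ─ p)

-- |N(a) Δ N(b)| / max(|N(a)|,|N(b)|); convention 0 if the max is 0
-- (never used under the edge hypothesis, since then both are nonempty).
NonAgreement : ∀ {n} → SignedGraph n → Fin n → Fin n → ℚ
NonAgreement X a b with ∣ N⁺ X a ∣ ⊔ ∣ N⁺ X b ∣
... | zero = 0ℚ
... | suc k = (+ ∣ N⁺ X a Δ N⁺ X b ∣) / suc k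

Agree : ∀ {n} → ℚ → SignedGraph n → Fin n → Fin n → Set
Agree ε X a b = Edge⁺ X a b × NonAgreement X a b < ε

flipToNeg : ∀ {n} → SignedGraph n → Fin n → Fin n → SignedGraph n
flipToNeg X u v a b =
  if (⌊ a ≟ u ⌋ ∧ ⌊ b ≟ v ⌋) ∨ (⌊ a ≟ v ⌋ ∧ ⌊ b ≟ u ⌋) then false else X a b

{-# OPTIONS --safe #-}
module Submission where

-- Flipping {u,v} to "-" deletes v from N⁺(u) and leaves N⁺(w) untouched (w ∉ {u,v}), so
-- |N⁺(u)| drops by one while N⁺(u) Δ N⁺(w) changes only at v: it loses v if v ∉ N⁺(w) and
-- gains v if v ∈ N⁺(w). Each case is then a comparison of the fractions t / max(deg u, deg w)
-- before and after the flip; the decisive one is t/a ≤ (t+1)/(a+1), which holds iff t ≤ a.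

open import Defs
open import Data.Nat using (ℕ; _≤_; _>_)
open import Data.Rational using (ℚ; 0ℚ; _<_)
open import Data.Bool using (true)
open import Data.Fin using (Fin)
open import Data.Fin.Subset using (∣_∣; _∈_; _∉_)
open import Data.Product using (_×_)
open import Relation.Nullary using (¬_)
open import Relation.Binary.PropositionalEquality using (_≡_)

import Data.Nat as ℕ
open import Data.Nat using (zero; suc; _⊔_; _*_; z≤n; s≤s; s≤s⁻¹; NonZero; >-nonZero)
open import Data.Nat.Properties
  using (≤-trans; n≤1+n; m≤n⇒m≤1+n; m≤n⊔m; ⊔-lub; ⊔-monoˡ-≤; m≥n⇒m⊔n≡m;
         *-mono-≤; *-suc; +-monoˡ-≤)
import Data.Integer as ℤ
open import Data.Integer using (+_; +≤+)
open import Data.Integer.Properties using (pos-*)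
open import Data.Rational using (fromℚᵘ) renaming (_≤_ to _≤ℚ_)
open import Data.Rational.Properties using (toℚᵘ-cancel-≤; toℚᵘ-fromℚᵘ; ≤-<-trans; module ≤-Reasoning)
open import Data.Rational.Unnormalised using (mkℚᵘ; *≤*) renaming (_≤_ to _≤ᵘ_)
open import Data.Rational.Unnormalised.Properties using (≤-respˡ-≃; ≤-respʳ-≃; ≃-sym)
open import Data.Bool using (false; if_then_else_; _∧_; not; _xor_)
open import Data.Bool.Properties using (¬-not)
open import Data.Fin using (_≟_; zero; suc)
open import Data.Fin.Properties using (suc-injective)
open import Data.Fin.Subset using (Subset; inside; outside)
open import Data.Fin.Subset.Properties using (x∈p⇒∣p-x∣<∣p∣)
open import Data.Vec using (Vec; _∷_; lookup)
open import Data.Vec.Properties using (lookup∘tabulate; tabulate∘lookup; tabulate-cong; []=⇒lookup; lookup⇒[]=)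
open import Data.Product using (_,_; proj₁; proj₂)
open import Function using (_∘_)
open import Relation.Nullary using (Dec; contradiction; yes; no)
open import Relation.Nullary.Decidable using (⌊_⌋)
open import Relation.Binary.PropositionalEquality
  using (_≢_; _≗_; refl; sym; trans; cong; cong₂; subst; subst₂; module ≡-Reasoning)

lookup-≗⇒≡ : ∀ {a} {A : Set a} {n} {xs ys : Vec A n} → lookup xs ≗ lookup ys → xs ≡ ys
lookup-≗⇒≡ {xs = xs} {ys} eq =
  trans (sym (tabulate∘lookup xs)) (trans (tabulate-cong eq) (tabulate∘lookup ys))

EqualExcept : ∀ {n} → Fin n → Subset n → Subset n → Set
EqualExcept x p q = ∀ y → y ≢ x → lookup p y ≡ lookup q y

EqualExcept-tail : ∀ {n} {x : Fin n} {s s′} {p q : Subset n} →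
  EqualExcept (suc x) (s ∷ p) (s′ ∷ q) → EqualExcept x p q
EqualExcept-tail eq y y≢x = eq (suc y) (y≢x ∘ suc-injective)

EqualExcept⇒∣p∣≡suc∣q∣ : ∀ {n} {p q : Subset n} x → EqualExcept x p q →
  lookup p x ≡ inside → lookup q x ≡ outside → ∣ p ∣ ≡ suc ∣ q ∣
EqualExcept⇒∣p∣≡suc∣q∣ {p = _ ∷ p} {_ ∷ q} zero eq refl refl =
  cong (ℕ.suc ∘ ∣_∣) (lookup-≗⇒≡ {xs = p} {q} λ y → eq (suc y) (λ ()))
EqualExcept⇒∣p∣≡suc∣q∣ {p = inside ∷ p} {inside ∷ q} (suc x) eq px qx =
  cong ℕ.suc (EqualExcept⇒∣p∣≡suc∣q∣ {p = p} {q} x (EqualExcept-tail eq) px qx)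
EqualExcept⇒∣p∣≡suc∣q∣ {p = outside ∷ p} {outside ∷ q} (suc x) eq px qx =
  EqualExcept⇒∣p∣≡suc∣q∣ {p = p} {q} x (EqualExcept-tail eq) px qx
EqualExcept⇒∣p∣≡suc∣q∣ {p = inside ∷ _} {outside ∷ _} (suc x) eq _ _ = contradiction (eq zero (λ ())) λ ()
EqualExcept⇒∣p∣≡suc∣q∣ {p = outside ∷ _} {inside ∷ _} (suc x) eq _ _ = contradiction (eq zero (λ ())) λ ()

lookup-Δ : ∀ {n} (p q : Subset n) x → lookup (p Δ q) x ≡ lookup p x xor lookup q x
lookup-Δ (inside  ∷ _) (inside  ∷ _) zero    = refl
lookup-Δ (inside  ∷ _) (outside ∷ _) zero    = refl
lookup-Δ (outside ∷ _) (inside  ∷ _) zero    = refl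
lookup-Δ (outside ∷ _) (outside ∷ _) zero    = refl
lookup-Δ (_ ∷ p)       (_ ∷ q)       (suc x) = lookup-Δ p q x

Δ-EqualExceptˡ : ∀ {n x} {p q : Subset n} (r : Subset n) → EqualExcept x p q → EqualExcept x (p Δ r) (q Δ r)
Δ-EqualExceptˡ {p = p} {q} r eq y y≢x = begin
  lookup (p Δ r) y            ≡⟨ lookup-Δ p r y ⟩
  lookup p y xor lookup r y   ≡⟨ cong (_xor lookup r y) (eq y y≢x) ⟩
  lookup q y xor lookup r y   ≡⟨ lookup-Δ q r y ⟨
  lookup (q Δ r) y            ∎
  where open ≡-Reasoning

∉⇒lookup≡outside : ∀ {n x} {p : Subset n} → x ∉ p → lookup p x ≡ outside
∉⇒lookup≡outside {x = x} {p} x∉p = ¬-not (x∉p ∘ lookup⇒[]= x p)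

lookup≡inside⇒0<∣p∣ : ∀ {n x} {p : Subset n} → lookup p x ≡ inside → 0 ℕ.< ∣ p ∣
lookup≡inside⇒0<∣p∣ {x = x} {p} px = ≤-trans (s≤s z≤n) (x∈p⇒∣p-x∣<∣p∣ (lookup⇒[]= x p px))

lookup-N⁺ : ∀ {n} (X : SignedGraph n) a x →
  lookup (N⁺ X a) x ≡ (if ⌊ x ≟ a ⌋ then outside else (if X a x then inside else outside))
lookup-N⁺ X a = lookup∘tabulate _

module _ {n} (X : SignedGraph n) {a : Fin n} where

  lookup-N⁺-self : lookup (N⁺ X a) a ≡ outside
  lookup-N⁺-self rewrite lookup-N⁺ X a a with a ≟ a
  ... | yes _   = refl
  ... | no a≢a  = contradiction refl a≢a

  lookup-N⁺-≢ : ∀ {x} → x ≢ a → lookup (N⁺ X a) x ≡ X a x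
  lookup-N⁺-≢ {x} x≢a rewrite lookup-N⁺ X a x with x ≟ a | X a x
  ... | yes x≡a | _     = contradiction x≡a x≢a
  ... | no _    | true  = refl
  ... | no _    | false = refl

  ∈N⁺⇒Edge⁺ : ∀ {x} → x ∈ N⁺ X a → Edge⁺ X a x
  ∈N⁺⇒Edge⁺ {x} x∈ with x ≟ a
  ... | yes refl = contradiction (trans (sym lookup-N⁺-self) ([]=⇒lookup x∈)) λ ()
  ... | no x≢a   = x≢a ∘ sym , trans (sym (lookup-N⁺-≢ x≢a)) ([]=⇒lookup x∈)

  lookup-N⁺-cong : ∀ (Y : SignedGraph n) {x} → X a x ≡ Y a x → lookup (N⁺ X a) x ≡ lookup (N⁺ Y a) x
  lookup-N⁺-cong Y {x} eq rewrite lookup-N⁺ X a x | lookup-N⁺ Y a x | eq = refl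

  N⁺-cong : ∀ (Y : SignedGraph n) → (∀ x → X a x ≡ Y a x) → N⁺ X a ≡ N⁺ Y a
  N⁺-cong Y eq = lookup-≗⇒≡ λ x → lookup-N⁺-cong Y (eq x)

N⁺-symmetric : ∀ {n} {X : SignedGraph n} → Symmetric X → ∀ a b → lookup (N⁺ X a) b ≡ lookup (N⁺ X b) a
N⁺-symmetric {X = X} X-sym a b with b ≟ a
... | yes refl = refl
... | no b≢a   = trans (lookup-N⁺-≢ X b≢a) (trans (X-sym a b) (sym (lookup-N⁺-≢ X (b≢a ∘ sym))))

∧-isYes-false : ∀ {a b} {A : Set a} {B : Set b} (A? : Dec A) (B? : Dec B) → ¬ (A × B) → ⌊ A? ⌋ ∧ ⌊ B? ⌋ ≡ false
∧-isYes-false (yes a) (yes b) ¬a×b = contradiction (a , b) ¬a×b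
∧-isYes-false (yes _) (no _)  _    = refl
∧-isYes-false (no _)  _       _    = refl

module _ {n} (G : SignedGraph n) (u v : Fin n) where

  flipToNeg-other : ∀ a b → ¬ (a ≡ u × b ≡ v) → ¬ (a ≡ v × b ≡ u) → flipToNeg G u v a b ≡ G a b
  flipToNeg-other a b ¬uv ¬vu rewrite ∧-isYes-false (a ≟ u) (b ≟ v) ¬uv | ∧-isYes-false (a ≟ v) (b ≟ u) ¬vu = refl

  flipToNeg-uv : flipToNeg G u v u v ≡ false
  flipToNeg-uv with u ≟ u | v ≟ v
  ... | yes _ | yes _ = refl
  ... | no u≢u | _    = contradiction refl u≢u
  ... | yes _ | no v≢v = contradiction refl v≢v

ratio : ℕ → ℕ → ℚ
ratio t zero    = 0ℚ
ratio t (suc m) = fromℚᵘ (mkℚᵘ (+ t) m)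

NonAgreement≡ratio : ∀ {n} (X : SignedGraph n) a b →
  NonAgreement X a b ≡ ratio ∣ N⁺ X a Δ N⁺ X b ∣ (∣ N⁺ X a ∣ ⊔ ∣ N⁺ X b ∣)
NonAgreement≡ratio X a b with ∣ N⁺ X a ∣ ⊔ ∣ N⁺ X b ∣
... | zero  = refl
... | suc _ = refl

fromℚᵘ-mono-≤ : ∀ {p q} → p ≤ᵘ q → fromℚᵘ p ≤ℚ fromℚᵘ q
fromℚᵘ-mono-≤ {p} {q} p≤q =
  toℚᵘ-cancel-≤ (≤-respˡ-≃ (≃-sym (toℚᵘ-fromℚᵘ p)) (≤-respʳ-≃ (≃-sym (toℚᵘ-fromℚᵘ q)) p≤q))

ratio-suc-mono : ∀ {t₁ m₁ t₂ m₂} → t₁ * suc m₂ ≤ t₂ * suc m₁ → ratio t₁ (suc m₁) ≤ℚ ratio t₂ (suc m₂)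
ratio-suc-mono {t₁} {m₁} {t₂} {m₂} le = fromℚᵘ-mono-≤ {mkℚᵘ (+ t₁) m₁} {mkℚᵘ (+ t₂) m₂}
  (*≤* (subst₂ ℤ._≤_ (pos-* t₁ (suc m₂)) (pos-* t₂ (suc m₁)) (+≤+ le)))

-- The junk value ratio t 0 = 0ℚ is definitionally ratio 0 1.
ratio-≤-of-cross-≤ : ∀ {t₁ m₁ t₂ m₂} .{{_ : NonZero m₂}} → t₁ * m₂ ≤ t₂ * m₁ → ratio t₁ m₁ ≤ℚ ratio t₂ m₂
ratio-≤-of-cross-≤ {t₁} {zero}   {t₂} {suc m₂} _  = ratio-suc-mono {0} {0} {t₂} {m₂} z≤n
ratio-≤-of-cross-≤ {t₁} {suc m₁} {t₂} {suc m₂} le = ratio-suc-mono {t₁} {m₁} {t₂} {m₂} le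

ratio-mono : ∀ {t₁ m₁ t₂ m₂} .{{_ : NonZero m₂}} → t₁ ≤ t₂ → m₂ ≤ m₁ → ratio t₁ m₁ ≤ℚ ratio t₂ m₂
ratio-mono {t₁} {m₁} {t₂} {m₂} t₁≤t₂ m₂≤m₁ = ratio-≤-of-cross-≤ {t₁} {m₁} {t₂} {m₂} (*-mono-≤ t₁≤t₂ m₂≤m₁)

ratio-≤-ratio-suc-suc : ∀ {t m} → t ≤ m → ratio t m ≤ℚ ratio (suc t) (suc m)
ratio-≤-ratio-suc-suc {t} {m} t≤m =
  ratio-≤-of-cross-≤ {t} {m} {suc t} {suc m} (subst (_≤ suc t * m) (sym (*-suc t m)) (+-monoˡ-≤ (t * m) t≤m))

ratio-suc-suc-≤-ratio : ∀ {t m} .{{_ : NonZero m}} → m ≤ t → ratio (suc t) (suc m) ≤ℚ ratio t m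
ratio-suc-suc-≤-ratio {t} {m} m≤t =
  ratio-≤-of-cross-≤ {suc t} {suc m} {t} {m} (subst (suc t * m ≤_) (sym (*-suc t m)) (+-monoˡ-≤ (t * m) m≤t))

module _ {n} {ε : ℚ} {X Y : SignedGraph n} {a b : Fin n} where

  Agree-transfer : Edge⁺ Y a b → NonAgreement Y a b ≤ℚ NonAgreement X a b → Agree ε X a b → Agree ε Y a b
  Agree-transfer edge le (_ , lt) = edge , ≤-<-trans le lt

  ¬Agree-transfer : Edge⁺ X a b → NonAgreement X a b ≤ℚ NonAgreement Y a b → ¬ Agree ε X a b → ¬ Agree ε Y a b
  ¬Agree-transfer edge le ¬agree (_ , lt) = ¬agree (edge , ≤-<-trans le lt)

module FlipEdge {n} (G : SignedGraph n) (G-sym : Symmetric G)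
                {u v : Fin n} (u≢v : u ≢ v) (Guv : G u v ≡ true)
                {w : Fin n} (w∈N⁺u : w ∈ N⁺ G u) where

  H : SignedGraph n
  H = flipToNeg G u v

  edge-uw : Edge⁺ G u w
  edge-uw = ∈N⁺⇒Edge⁺ G w∈N⁺u

  u≢w : u ≢ w
  u≢w = proj₁ edge-uw

  a b t T : ℕ
  a = ∣ N⁺ H u ∣
  b = ∣ N⁺ G w ∣
  t = ∣ N⁺ H u Δ N⁺ G w ∣
  T = ∣ N⁺ G u Δ N⁺ G w ∣

  N⁺u-loses-v : EqualExcept v (N⁺ G u) (N⁺ H u)
  N⁺u-loses-v y y≢v = lookup-N⁺-cong G H (sym (flipToNeg-other G u v u y (y≢v ∘ proj₂) (u≢v ∘ proj₁)))

  N⁺w-unchanged : w ≢ v → N⁺ H w ≡ N⁺ G w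
  N⁺w-unchanged w≢v = N⁺-cong H G λ y → flipToNeg-other G u v w y (u≢w ∘ sym ∘ proj₁) (w≢v ∘ proj₁)

  edge-H : w ≢ v → Edge⁺ H u w
  edge-H w≢v = u≢w , trans (flipToNeg-other G u v u w (w≢v ∘ proj₂) (u≢v ∘ proj₁)) (proj₂ edge-uw)

  v∈N⁺Gu : lookup (N⁺ G u) v ≡ inside
  v∈N⁺Gu = trans (lookup-N⁺-≢ G (u≢v ∘ sym)) Guv

  v∉N⁺Hu : lookup (N⁺ H u) v ≡ outside
  v∉N⁺Hu = trans (lookup-N⁺-≢ H (u≢v ∘ sym)) (flipToNeg-uv G u v)

  deg-u : ∣ N⁺ G u ∣ ≡ suc a
  deg-u = EqualExcept⇒∣p∣≡suc∣q∣ {p = N⁺ G u} {N⁺ H u} v N⁺u-loses-v v∈N⁺Gu v∉N⁺Hu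

  0<b : 0 ℕ.< b
  0<b = lookup≡inside⇒0<∣p∣ {p = N⁺ G w} (trans (N⁺-symmetric G-sym w u) ([]=⇒lookup w∈N⁺u))

  Δ-loses-v : EqualExcept v (N⁺ G u Δ N⁺ G w) (N⁺ H u Δ N⁺ G w)
  Δ-loses-v = Δ-EqualExceptˡ {p = N⁺ G u} {N⁺ H u} (N⁺ G w) N⁺u-loses-v

  lookup-ΔG-v : lookup (N⁺ G u Δ N⁺ G w) v ≡ not (lookup (N⁺ G v) w)
  lookup-ΔG-v = trans (lookup-Δ (N⁺ G u) (N⁺ G w) v) (cong₂ _xor_ v∈N⁺Gu (N⁺-symmetric G-sym w v))

  lookup-ΔH-v : lookup (N⁺ H u Δ N⁺ G w) v ≡ lookup (N⁺ G v) w
  lookup-ΔH-v = trans (lookup-Δ (N⁺ H u) (N⁺ G w) v) (cong₂ _xor_ v∉N⁺Hu (N⁺-symmetric G-sym w v))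

  T≡suc-t : w ∉ N⁺ G v → T ≡ suc t
  T≡suc-t w∉N⁺v = EqualExcept⇒∣p∣≡suc∣q∣ {p = N⁺ G u Δ N⁺ G w} {N⁺ H u Δ N⁺ G w} v Δ-loses-v
    (trans lookup-ΔG-v (cong not w-out)) (trans lookup-ΔH-v w-out)
    where w-out = ∉⇒lookup≡outside w∉N⁺v

  t≡suc-T : w ∈ N⁺ G v → t ≡ suc T
  t≡suc-T w∈N⁺v = EqualExcept⇒∣p∣≡suc∣q∣ {p = N⁺ H u Δ N⁺ G w} {N⁺ G u Δ N⁺ G w} v
    (λ y y≢v → sym (Δ-loses-v y y≢v)) (trans lookup-ΔH-v w-in) (trans lookup-ΔG-v (cong not w-in))
    where w-in = []=⇒lookup w∈N⁺v

  NA-G : NonAgreement G u w ≡ ratio T (suc a ⊔ b)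
  NA-G = trans (NonAgreement≡ratio G u w) (cong (λ d → ratio T (d ⊔ b)) deg-u)

  NA-H : w ≢ v → NonAgreement H u w ≡ ratio t (a ⊔ b)
  NA-H w≢v = trans (NonAgreement≡ratio H u w)
    (cong (λ N⁺w → ratio ∣ N⁺ H u Δ N⁺w ∣ (a ⊔ ∣ N⁺w ∣)) (N⁺w-unchanged w≢v))

  ⊔b-nonZero : ∀ x → NonZero (x ⊔ b)
  ⊔b-nonZero x = >-nonZero (≤-trans 0<b (m≤n⊔m x b))

  deg-w<deg-u⇒b≤a : ∣ N⁺ G w ∣ ℕ.< ∣ N⁺ G u ∣ → b ≤ a
  deg-w<deg-u⇒b≤a b<deg-u = s≤s⁻¹ (subst (suc b ≤_) deg-u b<deg-u)

  open ≤-Reasoning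

  flip-lowers-NA-if-deg-u≤deg-w : w ∉ N⁺ G v → w ≢ v → ∣ N⁺ G u ∣ ≤ ∣ N⁺ G w ∣ →
                                  NonAgreement H u w ≤ℚ NonAgreement G u w
  flip-lowers-NA-if-deg-u≤deg-w w∉N⁺v w≢v deg-u≤deg-w = begin
    NonAgreement H u w         ≡⟨ NA-H w≢v ⟩
    ratio t (a ⊔ b)            ≤⟨ ratio-mono {{⊔b-nonZero (suc a)}} (n≤1+n t) (⊔-lub 1+a≤a⊔b (m≤n⊔m a b)) ⟩
    ratio (suc t) (suc a ⊔ b)  ≡⟨ cong (λ k → ratio k (suc a ⊔ b)) (T≡suc-t w∉N⁺v) ⟨
    ratio T (suc a ⊔ b)        ≡⟨ NA-G ⟨
    NonAgreement G u w         ∎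
    where 1+a≤a⊔b = ≤-trans (subst (_≤ b) deg-u deg-u≤deg-w) (m≤n⊔m a b)

  flip-lowers-NA-if-Δ≤deg-u : w ∉ N⁺ G v → w ≢ v → ∣ N⁺ G u ∣ > ∣ N⁺ G w ∣ →
                              ∣ N⁺ G u Δ N⁺ G w ∣ ≤ ∣ N⁺ G u ∣ →
                              NonAgreement H u w ≤ℚ NonAgreement G u w
  flip-lowers-NA-if-Δ≤deg-u w∉N⁺v w≢v b<deg-u T≤deg-u = begin
    NonAgreement H u w     ≡⟨ NA-H w≢v ⟩
    ratio t (a ⊔ b)        ≡⟨ cong (ratio t) (m≥n⇒m⊔n≡m b≤a) ⟩
    ratio t a              ≤⟨ ratio-≤-ratio-suc-suc t≤a ⟩
    ratio (suc t) (suc a)  ≡⟨ cong₂ ratio (T≡suc-t w∉N⁺v) (m≥n⇒m⊔n≡m (m≤n⇒m≤1+n b≤a)) ⟨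
    ratio T (suc a ⊔ b)    ≡⟨ NA-G ⟨
    NonAgreement G u w     ∎
    where
    b≤a = deg-w<deg-u⇒b≤a b<deg-u
    t≤a = s≤s⁻¹ (subst₂ _≤_ (T≡suc-t w∉N⁺v) deg-u T≤deg-u)

  flip-raises-NA-if-w∈N⁺v : w ∈ N⁺ G v → NonAgreement G u w ≤ℚ NonAgreement H u w
  flip-raises-NA-if-w∈N⁺v w∈N⁺v = begin
    NonAgreement G u w     ≡⟨ NA-G ⟩
    ratio T (suc a ⊔ b)    ≤⟨ ratio-mono {{⊔b-nonZero a}} (n≤1+n T) (⊔-monoˡ-≤ b (n≤1+n a)) ⟩
    ratio (suc T) (a ⊔ b)  ≡⟨ cong (λ k → ratio k (a ⊔ b)) (t≡suc-T w∈N⁺v) ⟨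
    ratio t (a ⊔ b)        ≡⟨ NA-H (proj₁ (∈N⁺⇒Edge⁺ G w∈N⁺v) ∘ sym) ⟨
    NonAgreement H u w     ∎

  flip-raises-NA-if-Δ>deg-u : w ∉ N⁺ G v → w ≢ v → ∣ N⁺ G u ∣ > ∣ N⁺ G w ∣ →
                              ∣ N⁺ G u Δ N⁺ G w ∣ > ∣ N⁺ G u ∣ →
                              NonAgreement G u w ≤ℚ NonAgreement H u w
  flip-raises-NA-if-Δ>deg-u w∉N⁺v w≢v b<deg-u deg-u<T = begin
    NonAgreement G u w     ≡⟨ NA-G ⟩
    ratio T (suc a ⊔ b)    ≡⟨ cong₂ ratio (T≡suc-t w∉N⁺v) (m≥n⇒m⊔n≡m (m≤n⇒m≤1+n b≤a)) ⟩
    ratio (suc t) (suc a)  ≤⟨ ratio-suc-suc-≤-ratio {{>-nonZero (≤-trans 0<b b≤a)}} a≤t ⟩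
    ratio t a              ≡⟨ cong (ratio t) (m≥n⇒m⊔n≡m b≤a) ⟨
    ratio t (a ⊔ b)        ≡⟨ NA-H w≢v ⟨
    NonAgreement H u w     ∎
    where
    b≤a = deg-w<deg-u⇒b≤a b<deg-u
    a≤t = ≤-trans (n≤1+n a) (s≤s⁻¹ (subst₂ (ℕ._<_) deg-u (T≡suc-t w∉N⁺v) deg-u<T))

proposition3 : (ε : ℚ) → 0ℚ < ε → (n : ℕ) (G : SignedGraph n) → Symmetric G →
  (u v : Fin n) → ¬ (u ≡ v) → G u v ≡ true →
  (w : Fin n) → w ∈ N⁺ G u →
  ((Agree ε G u w →
      ((w ∉ N⁺ G v × ¬ (w ≡ v) × ∣ N⁺ G u ∣ ≤ ∣ N⁺ G w ∣)
       → Agree ε (flipToNeg G u v) u w)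
    × ((w ∉ N⁺ G v × ¬ (w ≡ v) × ∣ N⁺ G u ∣ > ∣ N⁺ G w ∣
        × ∣ N⁺ G u Δ N⁺ G w ∣ ≤ ∣ N⁺ G u ∣)
       → Agree ε (flipToNeg G u v) u w))
  × (¬ Agree ε G u w →
      ((w ∈ N⁺ G v) → ¬ Agree ε (flipToNeg G u v) u w)
    × ((w ∉ N⁺ G v × ¬ (w ≡ v) × ∣ N⁺ G u ∣ > ∣ N⁺ G w ∣
        × ∣ N⁺ G u Δ N⁺ G w ∣ > ∣ N⁺ G u ∣)
       → ¬ Agree ε (flipToNeg G u v) u w)))
proposition3 ε _ n G G-sym u v u≢v Guv w w∈N⁺u =
  (λ agree →
      (λ (w∉N⁺v , w≢v , deg-u≤deg-w) →
         Agree-transfer (edge-H w≢v) (flip-lowers-NA-if-deg-u≤deg-w w∉N⁺v w≢v deg-u≤deg-w) agree)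
    , (λ (w∉N⁺v , w≢v , deg-u>deg-w , T≤deg-u) →
         Agree-transfer (edge-H w≢v) (flip-lowers-NA-if-Δ≤deg-u w∉N⁺v w≢v deg-u>deg-w T≤deg-u) agree))
  , (λ ¬agree →
      (λ w∈N⁺v →
         ¬Agree-transfer edge-uw (flip-raises-NA-if-w∈N⁺v w∈N⁺v) ¬agree)
    , (λ (w∉N⁺v , w≢v , deg-u>deg-w , T>deg-u) →
         ¬Agree-transfer edge-uw (flip-raises-NA-if-Δ>deg-u w∉N⁺v w≢v deg-u>deg-w T>deg-u) ¬agree))
  where open FlipEdge G G-sym u≢v Guv w∈N⁺u
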